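{- For all integers $n$ and $k$, $\binom{n}{k}_q = \binom{n}{n-k}_q = (-1)^{n-k}\operatorname{sgn}(n-k)\,q^{\frac12(n(n+1)-k(k+1))}\binom{ -k-1}{n-k}_q = (-1)^{n-k}\operatorname{sgn}(n-k)\,q^{\frac12(n(n+1)-k(k+1))}\binom{ -k-1}{ -n-1}_q = (-1)^k\operatorname{sgn}(k)\,q^{\frac12 k(2n-k+1)}\binom{k-n-1}{ -n-1}_q = (-1)^k\operatorname{sgn}(k)\,q^{\frac12 k(2n-k+1)}\binom{k-n-1}{k}_q.$
   Context: For an integer $n\ge 0$, $(a;q)_n=\prod_{j=0}^{n-1}(1-aq^j)$, and for $n<0$, $(a;q)_n=\prod_{j=1}^{|n|}\frac{1}{1-aq^{ -j}}$. For all integers $n,k$, $\binom{n}{k}_q := \lim_{a\to q} \frac{(a;q)_n}{(a;q)_k\,(a;q)_{n-k}}$ (a Laurent polynomial in $q$). The sign function is $\operatorname{sgn}(k)=1$ if $k\ge0$ and $-1$ if $k<0$. -}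

module Defs where

open import Data.Bool using (Bool; true; false; not; if_then_else_)
open import Data.Nat using (ℕ; zero; suc)
open import Data.Integer using (ℤ; +_; -[1+_]; _+_; _-_; _*_; -_; ∣_∣)
open import Data.Integer.DivMod using (_/ℕ_)
import Data.Integer as ℤ
import Data.Nat as ℕ
open import Data.List using (List; []; _∷_; _++_; map; concatMap; upTo; foldr)
open import Data.Maybe using (Maybe; just; nothing)
open import Data.Product using (_×_; _,_)
open import Data.Empty using (⊥)
open import Relation.Nullary using (does)
open import Relation.Binary.PropositionalEquality using (_≡_)

-- Laurent polynomials in q with integer coefficients,
-- represented as finite formal sums of monomials  c · q^e  (pairs (c , e)).

LPoly : Set
LPoly = List (ℤ × ℤ)

coeff : LPoly → ℤ → ℤ
coeff []             i = + 0
coeff ((c , e) ∷ p) i = (if does (e ℤ.≟ i) then c else + 0) + coeff p i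

_≈L_ : LPoly → LPoly → Set
p ≈L r = ∀ i → coeff p i ≡ coeff r i

_⊗_ : LPoly → LPoly → LPoly
p ⊗ r = concatMap (λ { (c , e) → map (λ { (d , f) → (c * d , e + f) }) r }) p

oneL : LPoly
oneL = (+ 1 , + 0) ∷ []

zeroL : LPoly
zeroL = []

mono : ℤ → ℤ → LPoly
mono c e = (c , e) ∷ []

-- Rational functions in q: fractions num / den of Laurent polynomials,
-- with the usual equality of fractions.

record Frac : Set where
  constructor _/_
  field
    num : LPoly
    den : LPoly
open Frac public

_≈F_ : Frac → Frac → Set
x ≈F y = (num x ⊗ den y) ≈L (num y ⊗ den x)

-- values of the q-binomial: 'nothing' would mean the limit a → q does
-- not exist (it never happens, but we do not assume it).
_≈_ : Maybe Frac → Maybe Frac → Set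
just x ≈ just y = x ≈F y
_      ≈ _      = ⊥

scale : ℤ → ℤ → Maybe Frac → Maybe Frac
scale c e (just (a / b)) = just ((mono c e ⊗ a) / b)
scale c e nothing        = nothing

-- q-Pochhammer symbols (a;q)_n, kept as formal products of factors
-- (1 - a q^j)^{±1}:  (j , true) is a numerator factor, (j , false) a
-- denominator factor.

Factors : Set
Factors = List (ℤ × Bool)

-- (a;q)_n = ∏_{j=0}^{n-1} (1 - a q^j)           for n ≥ 0
-- (a;q)_n = ∏_{j=1}^{|n|} 1/(1 - a q^{-j})       for n < 0
poch : ℤ → Factors
poch (+ n)      = map (λ j → (+ j , true)) (upTo n)
poch -[1+ m ]   = map (λ i → (-[1+ i ] , false)) (upTo (suc m))

invF : Factors → Factors
invF = map (λ { (j , b) → (j , not b) })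

qbinRatio : ℤ → ℤ → Factors
qbinRatio n k = poch n ++ invF (poch k) ++ invF (poch (n - k))

-- order of vanishing at a = q, i.e. the signed multiplicity of the
-- factor (1 - a q^{-1})
isMinusOne : ℤ → Bool
isMinusOne j = does (j ℤ.≟ -[1+ 0 ])

orderAtQ : Factors → ℤ
orderAtQ []              = + 0
orderAtQ ((j , b) ∷ fs) =
  (if isMinusOne j then (if b then + 1 else -[1+ 0 ]) else + 0) + orderAtQ fs

-- 1 - q^{j+1}  (the factor 1 - a q^j evaluated at a = q)
factorAtQ : ℤ → LPoly
factorAtQ j = (+ 1 , + 0) ∷ (-[1+ 0 ] , j + + 1) ∷ []

evalAtQ : Factors → Frac
evalAtQ []              = oneL / oneL
evalAtQ ((j , b) ∷ fs) with isMinusOne j | b | evalAtQ fs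
... | true  | _     | x       = x
... | false | true  | (u / v) = (factorAtQ j ⊗ u) / v
... | false | false | (u / v) = u / (factorAtQ j ⊗ v)

-- lim_{a→q} of a formal product of factors (1 - a q^j)^{±1}, in ℚ(q):
-- if the vanishing factor (1 - a q^{-1}) occurs with positive net
-- multiplicity, the limit is 0; with multiplicity 0 it is the product of
-- the remaining factors at a = q; with negative multiplicity there is no
-- (finite) limit.
limAtQ : Factors → Maybe Frac
limAtQ fs with orderAtQ fs
... | + 0      = just (evalAtQ fs)
... | + suc _  = just (zeroL / oneL)
... | -[1+ _ ] = nothing

qbinom : ℤ → ℤ → Maybe Frac
qbinom n k = limAtQ (qbinRatio n k)

sgn : ℤ → ℤ
sgn (+ _)      = + 1
sgn -[1+ _ ]   = -[1+ 0 ]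

negOnePow : ℤ → ℤ
negOnePow m = if does (∣ m ∣ ℕ.% 2 ℕ.≟ 0) then + 1 else -[1+ 0 ]

-- x / 2 (used only for even x)
half : ℤ → ℤ
half x = x /ℕ 2

-- At a = q, (a;q)_x equals (q;q)_x for x ≥ 0, while for x = -(m+1) < 0 it is the pole factor
-- 1/(1 - a/q) times 1/∏_{i=1}^{m} (1 - q^{-i}), and reflecting every factor,
-- 1 - q^{-i} = -q^{-i} (1 - q^i), turns this product into (-1)^m q^{-m(m+1)/2} (q;q)_m.
-- So in the ratio defining the binomial for n, k and d = n - k the pole factor occurs with
-- multiplicity 0, 1 or 2: in the last two cases the value is 0 on both sides of each identity, and
-- in the regular cases it is a signed power of q times a ratio of q-factorials of three
-- nonnegative numbers, one the sum of the other two.  Both k ↦ n - k and the reflection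
-- (n, k) ↦ (k - n - 1, k) only permute these three numbers, the reflection trading
-- (-1)^m q^{-m(m+1)/2} factors, whence the sign (-1)^k sgn k and the power
-- q^{(n(n+1) - d(d+1))/2}; the five identities alternate these two moves.

module Submission where

open import Defs
open import Algebra.Bundles using (CommutativeMonoid)
open import Data.Bool using (Bool; true; false; if_then_else_)
open import Data.Integer as ℤ using (ℤ; +_; -[1+_]; _+_; _-_; _*_; -_; ∣_∣)
import Data.Integer.Properties as ℤ
open import Data.Integer.Tactic.RingSolver using (solve-∀)
open import Data.List using ([]; _∷_; _++_; map; applyUpTo; upTo)
import Data.List.Properties as List
open import Data.Maybe using (just)
open import Data.Nat as ℕ using (ℕ; zero; suc)
import Data.Nat.Properties as ℕ
open import Data.Nat.DivMod using ([m+kn]%n≡m%n; m*n%n≡0; m*n/n≡m)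
import Data.Nat.Tactic.RingSolver as ℕ-Solver
open import Data.Product using (_×_; _,_; Σ)
open import Function using (_∘_)
open import Relation.Binary.PropositionalEquality
open import Relation.Nullary using (does; yes; no; contradiction)

-- Laurent polynomials

monoCoeff : ℤ → ℤ → ℤ → ℤ
monoCoeff c e i = if does (e ℤ.≟ i) then c else + 0

sumTerms : (ℤ → ℤ → ℤ) → LPoly → ℤ
sumTerms h []            = + 0
sumTerms h ((c , e) ∷ p) = h c e + sumTerms h p

sumTerms-cong : ∀ {g h} p → (∀ c e → g c e ≡ h c e) → sumTerms g p ≡ sumTerms h p
sumTerms-cong []            g≡h = refl
sumTerms-cong ((c , e) ∷ p) g≡h = cong₂ _+_ (g≡h c e) (sumTerms-cong p g≡h)

sumTerms-+ : ∀ g h p → sumTerms (λ c e → g c e + h c e) p ≡ sumTerms g p + sumTerms h p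
sumTerms-+ g h []            = refl
sumTerms-+ g h ((c , e) ∷ p) rewrite sumTerms-+ g h p =
  interchange (g c e) (h c e) (sumTerms g p) (sumTerms h p)
  where
  interchange : ∀ a b x y → a + b + (x + y) ≡ a + x + (b + y)
  interchange = solve-∀

sumTerms-zero : ∀ p → sumTerms (λ _ _ → + 0) p ≡ + 0
sumTerms-zero []      = refl
sumTerms-zero (_ ∷ p) = trans (ℤ.+-identityˡ _) (sumTerms-zero p)

*-sumTerms : ∀ k h p → k * sumTerms h p ≡ sumTerms (λ c e → k * h c e) p
*-sumTerms k h []            = ℤ.*-zeroʳ k
*-sumTerms k h ((c , e) ∷ p) =
  trans (ℤ.*-distribˡ-+ k (h c e) (sumTerms h p)) (cong (λ t → k * h c e + t) (*-sumTerms k h p))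

sumTerms-++ : ∀ h p r → sumTerms h (p ++ r) ≡ sumTerms h p + sumTerms h r
sumTerms-++ h []            r = sym (ℤ.+-identityˡ _)
sumTerms-++ h ((c , e) ∷ p) r rewrite sumTerms-++ h p r = sym (ℤ.+-assoc (h c e) _ _)

sumTerms-swap : ∀ (H : ℤ → ℤ → ℤ → ℤ → ℤ) p r →
  sumTerms (λ c e → sumTerms (H c e) r) p ≡ sumTerms (λ d f → sumTerms (λ c e → H c e d f) p) r
sumTerms-swap H []            r = sym (sumTerms-zero r)
sumTerms-swap H ((c , e) ∷ p) r rewrite sumTerms-swap H p r =
  sym (sumTerms-+ (H c e) (λ d f → sumTerms (λ c′ e′ → H c′ e′ d f) p) r)

sumTerms-mono⊗ : ∀ h c e r → sumTerms h (mono c e ⊗ r) ≡ sumTerms (λ d f → h (c * d) (e + f)) r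
sumTerms-mono⊗ h c e []            = refl
sumTerms-mono⊗ h c e ((d , f) ∷ r) = cong (λ t → h (c * d) (e + f) + t) (sumTerms-mono⊗ h c e r)

sumTerms-⊗ : ∀ h p r → sumTerms h (p ⊗ r) ≡ sumTerms (λ c e → sumTerms (λ d f → h (c * d) (e + f)) r) p
sumTerms-⊗ h []            r = refl
sumTerms-⊗ h ((c , e) ∷ p) r = begin
  sumTerms h (map _ r ++ p ⊗ r)                ≡⟨ sumTerms-++ h (map _ r) (p ⊗ r) ⟩
  sumTerms h (map _ r) + sumTerms h (p ⊗ r)    ≡⟨ cong₂ _+_ mono-part (sumTerms-⊗ h p r) ⟩
  _                                            ∎
  where
  open ≡-Reasoning
  mono-part : sumTerms h (map _ r) ≡ sumTerms (λ d f → h (c * d) (e + f)) r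
  mono-part = trans (cong (sumTerms h) (sym (List.++-identityʳ (map _ r)))) (sumTerms-mono⊗ h c e r)

coeff-sumTerms : ∀ p i → coeff p i ≡ sumTerms (λ c e → monoCoeff c e i) p
coeff-sumTerms []            i = refl
coeff-sumTerms ((c , e) ∷ p) i = cong (λ t → monoCoeff c e i + t) (coeff-sumTerms p i)

coeff-++ : ∀ p r i → coeff (p ++ r) i ≡ coeff p i + coeff r i
coeff-++ []            r i = sym (ℤ.+-identityˡ _)
coeff-++ ((c , e) ∷ p) r i rewrite coeff-++ p r i = sym (ℤ.+-assoc (monoCoeff c e i) _ _)

monoCoeff-shift : ∀ c d e f i → monoCoeff (c * d) (e + f) i ≡ c * monoCoeff d f (i - e)
monoCoeff-shift c d e f i with (e + f) ℤ.≟ i | f ℤ.≟ (i - e)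
... | yes _ | yes _ = refl
... | no _  | no _  = sym (ℤ.*-zeroʳ c)
... | yes e+f≡i | no f≢i-e = contradiction (trans (sym (cancel e f)) (cong (_- e) e+f≡i)) f≢i-e
  where
  cancel : ∀ e f → e + f - e ≡ f
  cancel = solve-∀
... | no e+f≢i | yes f≡i-e = contradiction (trans (cong (λ t → e + t) f≡i-e) (cancel e i)) e+f≢i
  where
  cancel : ∀ e i → e + (i - e) ≡ i
  cancel = solve-∀

coeff-mono⊗ : ∀ c e r i → coeff (mono c e ⊗ r) i ≡ c * coeff r (i - e)
coeff-mono⊗ c e []            i = sym (ℤ.*-zeroʳ c)
coeff-mono⊗ c e ((d , f) ∷ r) i =
  trans (cong₂ _+_ (monoCoeff-shift c d e f i) (coeff-mono⊗ c e r i)) (sym (ℤ.*-distribˡ-+ c _ _))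

coeff-⊗ : ∀ p r i → coeff (p ⊗ r) i ≡ sumTerms (λ c e → c * coeff r (i - e)) p
coeff-⊗ []            r i = refl
coeff-⊗ ((c , e) ∷ p) r i = begin
  coeff (map _ r ++ p ⊗ r) i                 ≡⟨ coeff-++ (map _ r) (p ⊗ r) i ⟩
  coeff (map _ r) i + coeff (p ⊗ r) i
    ≡⟨ cong (λ t → coeff t i + coeff (p ⊗ r) i) (sym (List.++-identityʳ (map _ r))) ⟩
  coeff (mono c e ⊗ r) i + coeff (p ⊗ r) i   ≡⟨ cong₂ _+_ (coeff-mono⊗ c e r i) (coeff-⊗ p r i) ⟩
  _                                          ∎
  where open ≡-Reasoning

coeff-⊗-double : ∀ p r i →
  coeff (p ⊗ r) i ≡ sumTerms (λ c e → sumTerms (λ d f → monoCoeff (c * d) (e + f) i) r) p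
coeff-⊗-double p r i = trans (coeff-⊗ p r i) (sumTerms-cong p λ c e →
  trans (cong (c *_) (coeff-sumTerms r (i - e)))
        (trans (*-sumTerms c _ r) (sumTerms-cong r λ d f → sym (monoCoeff-shift c d e f i))))

⊗-comm : ∀ p r → (p ⊗ r) ≈L (r ⊗ p)
⊗-comm p r i = begin
  coeff (p ⊗ r) i                                                          ≡⟨ coeff-⊗-double p r i ⟩
  sumTerms (λ c e → sumTerms (λ d f → monoCoeff (c * d) (e + f) i) r) p  ≡⟨ sumTerms-swap _ p r ⟩
  sumTerms (λ d f → sumTerms (λ c e → monoCoeff (c * d) (e + f) i) p) r
    ≡⟨ sumTerms-cong r (λ d f → sumTerms-cong p λ c e → cong₂ (λ x y → monoCoeff x y i) (ℤ.*-comm c d) (ℤ.+-comm e f)) ⟩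
  sumTerms (λ d f → sumTerms (λ c e → monoCoeff (d * c) (f + e) i) p) r  ≡⟨ coeff-⊗-double r p i ⟨
  coeff (r ⊗ p) i                                                          ∎
  where open ≡-Reasoning

⊗-assoc : ∀ p r s → ((p ⊗ r) ⊗ s) ≈L (p ⊗ (r ⊗ s))
⊗-assoc p r s i = begin
  coeff ((p ⊗ r) ⊗ s) i                                                      ≡⟨ coeff-⊗ (p ⊗ r) s i ⟩
  sumTerms (λ c e → c * coeff s (i - e)) (p ⊗ r)                             ≡⟨ sumTerms-⊗ _ p r ⟩
  sumTerms (λ c e → sumTerms (λ d f → c * d * coeff s (i - (e + f))) r) p   ≡⟨ sumTerms-cong p inner ⟨
  sumTerms (λ c e → c * coeff (r ⊗ s) (i - e)) p                             ≡⟨ coeff-⊗ p (r ⊗ s) i ⟨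
  coeff (p ⊗ (r ⊗ s)) i                                                      ∎
  where
  open ≡-Reasoning
  shift : ∀ i e f → i - e - f ≡ i - (e + f)
  shift = solve-∀
  inner : ∀ c e → c * coeff (r ⊗ s) (i - e) ≡ sumTerms (λ d f → c * d * coeff s (i - (e + f))) r
  inner c e =
    trans (cong (c *_) (coeff-⊗ r s (i - e)))
    (trans (*-sumTerms c _ r) (sumTerms-cong r λ d f →
      trans (sym (ℤ.*-assoc c d _)) (cong (λ j → c * d * coeff s j) (shift i e f))))

⊗-congʳ : ∀ p {r r′} → r ≈L r′ → (p ⊗ r) ≈L (p ⊗ r′)
⊗-congʳ p {r} {r′} r≈r′ i =
  trans (coeff-⊗ p r i) (trans (sumTerms-cong p (λ c e → cong (c *_) (r≈r′ (i - e)))) (sym (coeff-⊗ p r′ i)))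

⊗-identityˡ : ∀ p → (oneL ⊗ p) ≈L p
⊗-identityˡ p i =
  trans (coeff-⊗ oneL p i) (trans (ℤ.+-identityʳ _) (trans (ℤ.*-identityˡ _) (cong (coeff p) (ℤ.+-identityʳ i))))

-- A record around _≈L_, so that both polynomials can be inferred from an equality proof.
infix 4 _≋_
record _≋_ (p r : LPoly) : Set where
  constructor ⟨_⟩
  field coeff-≡ : p ≈L r
open _≋_

⊗-commutativeMonoid : CommutativeMonoid _ _
⊗-commutativeMonoid = record
  { Carrier = LPoly ; _≈_ = _≋_ ; _∙_ = _⊗_ ; ε = oneL
  ; isCommutativeMonoid = record
    { isMonoid = record
      { isSemigroup = record
        { isMagma = record
          { isEquivalence = record
            { refl  = ⟨ (λ _ → refl) ⟩
            ; sym   = λ { ⟨ p≈r ⟩ → ⟨ (λ i → sym (p≈r i)) ⟩ }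
            ; trans = λ { ⟨ p≈r ⟩ ⟨ r≈s ⟩ → ⟨ (λ i → trans (p≈r i) (r≈s i)) ⟩ } }
          ; ∙-cong = λ { {p} {p′} {r} {r′} ⟨ p≈p′ ⟩ ⟨ r≈r′ ⟩ → ⟨ (λ i → trans (⊗-congʳ p r≈r′ i)
                           (trans (⊗-comm p r′ i) (trans (⊗-congʳ r′ p≈p′ i) (⊗-comm r′ p′ i)))) ⟩ } }
        ; assoc = λ p r s → ⟨ ⊗-assoc p r s ⟩ }
      ; identity = (λ p → ⟨ ⊗-identityˡ p ⟩)
                 , (λ p → ⟨ (λ i → trans (⊗-comm p oneL i) (⊗-identityˡ p i)) ⟩) }
    ; comm = λ p r → ⟨ ⊗-comm p r ⟩ } }

open CommutativeMonoid ⊗-commutativeMonoid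
  using (∙-cong; ∙-congˡ; ∙-congʳ; assoc; identityˡ; identityʳ)
  renaming (refl to ≋-refl; sym to ≋-sym; trans to ≋-trans)
open import Algebra.Solver.CommutativeMonoid ⊗-commutativeMonoid using (solve; _⊕_; _⊜_; id)

≡⇒≋ : ∀ {p r} → p ≡ r → p ≋ r
≡⇒≋ refl = ≋-refl

-- Evaluation at a = q

numAtQ : Factors → LPoly
numAtQ []             = oneL
numAtQ ((j , b) ∷ fs) with isMinusOne j | b
... | true  | _     = numAtQ fs
... | false | true  = factorAtQ j ⊗ numAtQ fs
... | false | false = numAtQ fs

denAtQ : Factors → LPoly
denAtQ []             = oneL
denAtQ ((j , b) ∷ fs) with isMinusOne j | b
... | true  | _     = denAtQ fs
... | false | true  = denAtQ fs
... | false | false = factorAtQ j ⊗ denAtQ fs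

num-evalAtQ : ∀ fs → num (evalAtQ fs) ≡ numAtQ fs
num-evalAtQ []             = refl
num-evalAtQ ((j , b) ∷ fs) with isMinusOne j | b
... | true  | _     = num-evalAtQ fs
... | false | true  = cong (factorAtQ j ⊗_) (num-evalAtQ fs)
... | false | false = num-evalAtQ fs

den-evalAtQ : ∀ fs → den (evalAtQ fs) ≡ denAtQ fs
den-evalAtQ []             = refl
den-evalAtQ ((j , b) ∷ fs) with isMinusOne j | b
... | true  | _     = den-evalAtQ fs
... | false | true  = den-evalAtQ fs
... | false | false = cong (factorAtQ j ⊗_) (den-evalAtQ fs)

numAtQ-++ : ∀ fs gs → numAtQ (fs ++ gs) ≋ numAtQ fs ⊗ numAtQ gs
numAtQ-++ []             gs = ≋-sym (identityˡ (numAtQ gs))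
numAtQ-++ ((j , b) ∷ fs) gs with isMinusOne j | b
... | true  | _     = numAtQ-++ fs gs
... | false | false = numAtQ-++ fs gs
... | false | true  = ≋-trans (∙-congˡ {factorAtQ j} (numAtQ-++ fs gs)) (≋-sym (assoc (factorAtQ j) (numAtQ fs) (numAtQ gs)))

denAtQ-++ : ∀ fs gs → denAtQ (fs ++ gs) ≋ denAtQ fs ⊗ denAtQ gs
denAtQ-++ []             gs = ≋-sym (identityˡ (denAtQ gs))
denAtQ-++ ((j , b) ∷ fs) gs with isMinusOne j | b
... | true  | _     = denAtQ-++ fs gs
... | false | true  = denAtQ-++ fs gs
... | false | false = ≋-trans (∙-congˡ {factorAtQ j} (denAtQ-++ fs gs)) (≋-sym (assoc (factorAtQ j) (denAtQ fs) (denAtQ gs)))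

numAtQ-invF : ∀ fs → numAtQ (invF fs) ≡ denAtQ fs
numAtQ-invF []             = refl
numAtQ-invF ((j , b) ∷ fs) with isMinusOne j | b
... | true  | true  = numAtQ-invF fs
... | true  | false = numAtQ-invF fs
... | false | true  = numAtQ-invF fs
... | false | false = cong (factorAtQ j ⊗_) (numAtQ-invF fs)

denAtQ-invF : ∀ fs → denAtQ (invF fs) ≡ numAtQ fs
denAtQ-invF []             = refl
denAtQ-invF ((j , b) ∷ fs) with isMinusOne j | b
... | true  | true  = denAtQ-invF fs
... | true  | false = denAtQ-invF fs
... | false | true  = cong (factorAtQ j ⊗_) (denAtQ-invF fs)
... | false | false = denAtQ-invF fs

orderAtQ-++ : ∀ fs gs → orderAtQ (fs ++ gs) ≡ orderAtQ fs + orderAtQ gs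
orderAtQ-++ []             gs = sym (ℤ.+-identityˡ _)
orderAtQ-++ ((j , b) ∷ fs) gs rewrite orderAtQ-++ fs gs =
  sym (ℤ.+-assoc (if isMinusOne j then (if b then + 1 else -[1+ 0 ]) else + 0) (orderAtQ fs) (orderAtQ gs))

orderAtQ-invF : ∀ fs → orderAtQ (invF fs) ≡ - orderAtQ fs
orderAtQ-invF []             = refl
orderAtQ-invF ((j , b) ∷ fs) rewrite orderAtQ-invF fs with isMinusOne j | b
... | true  | true  = sym (ℤ.neg-distrib-+ (+ 1) (orderAtQ fs))
... | true  | false = sym (ℤ.neg-distrib-+ -[1+ 0 ] (orderAtQ fs))
... | false | _     = sym (ℤ.neg-distrib-+ (+ 0) (orderAtQ fs))

qqPoch : ℕ → LPoly
qqPoch zero    = oneL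
qqPoch (suc m) = qqPoch m ⊗ factorAtQ (+ m)

minusOnePow : ℕ → ℤ
minusOnePow zero    = + 1
minusOnePow (suc m) = minusOnePow m * -[1+ 0 ]

tri : ℕ → ℕ
tri zero    = 0
tri (suc m) = tri m ℕ.+ suc m

negPochMono : ℕ → LPoly
negPochMono m = mono (minusOnePow m) (- (+ tri m))

-- (a;q)_x at a = q is pochNum x / pochDen x times (1 - a/q)^(pochOrder x).
pochNum : ℤ → LPoly
pochNum (+ m)    = qqPoch m
pochNum -[1+ m ] = oneL

pochDen : ℤ → LPoly
pochDen (+ m)    = oneL
pochDen -[1+ m ] = negPochMono m ⊗ qqPoch m

pochOrder : ℤ → ℤ
pochOrder (+ _)    = + 0
pochOrder -[1+ _ ] = -[1+ 0 ]

numAtQ-applyUpTo-suc : ∀ (h : ℕ → ℤ × Bool) m →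
  numAtQ (applyUpTo h (suc m)) ≋ numAtQ (applyUpTo h m) ⊗ numAtQ (h m ∷ [])
numAtQ-applyUpTo-suc h m =
  ≋-trans (≡⇒≋ (cong numAtQ (sym (List.applyUpTo-∷ʳ h m)))) (numAtQ-++ (applyUpTo h m) (h m ∷ []))

denAtQ-applyUpTo-suc : ∀ (h : ℕ → ℤ × Bool) m →
  denAtQ (applyUpTo h (suc m)) ≋ denAtQ (applyUpTo h m) ⊗ denAtQ (h m ∷ [])
denAtQ-applyUpTo-suc h m =
  ≋-trans (≡⇒≋ (cong denAtQ (sym (List.applyUpTo-∷ʳ h m)))) (denAtQ-++ (applyUpTo h m) (h m ∷ []))

posTerms : ℕ → Factors
posTerms = applyUpTo (λ j → (+ j , true))

negTerms : ℕ → Factors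
negTerms = applyUpTo (λ i → (-[1+ suc i ] , false))

poch-+ : ∀ m → poch (+ m) ≡ posTerms m
poch-+ m = List.map-upTo _ m

poch-neg : ∀ m → poch -[1+ m ] ≡ (-[1+ 0 ] , false) ∷ negTerms m
poch-neg m = cong ((-[1+ 0 ] , false) ∷_) (List.map-applyUpTo suc _ m)

negTerms-upTo : ∀ m → negTerms m ≡ map (λ i → (-[1+ suc i ] , false)) (upTo m)
negTerms-upTo m = sym (List.map-upTo _ m)

denAtQ-numerators : ∀ js → denAtQ (map (λ j → (+ j , true)) js) ≡ oneL
denAtQ-numerators []       = refl
denAtQ-numerators (_ ∷ js) = denAtQ-numerators js

orderAtQ-numerators : ∀ js → orderAtQ (map (λ j → (+ j , true)) js) ≡ + 0
orderAtQ-numerators []       = refl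
orderAtQ-numerators (_ ∷ js) = trans (ℤ.+-identityˡ _) (orderAtQ-numerators js)

numAtQ-denominators : ∀ is → numAtQ (map (λ i → (-[1+ suc i ] , false)) is) ≡ oneL
numAtQ-denominators []       = refl
numAtQ-denominators (_ ∷ is) = numAtQ-denominators is

orderAtQ-denominators : ∀ is → orderAtQ (map (λ i → (-[1+ suc i ] , false)) is) ≡ + 0
orderAtQ-denominators []       = refl
orderAtQ-denominators (_ ∷ is) = trans (ℤ.+-identityˡ _) (orderAtQ-denominators is)

numAtQ-posTerms : ∀ m → numAtQ (posTerms m) ≋ qqPoch m
numAtQ-posTerms zero    = ≋-refl
numAtQ-posTerms (suc m) = ≋-trans (numAtQ-applyUpTo-suc _ m) (∙-cong (numAtQ-posTerms m) (identityʳ (factorAtQ (+ m))))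

factorAtQ-reflect : ∀ m → factorAtQ -[1+ suc m ] ≋ mono -[1+ 0 ] -[1+ m ] ⊗ factorAtQ (+ m)
factorAtQ-reflect m = ⟨ (λ i → trans (swap (monoCoeff (+ 1) (+ 0) i) (monoCoeff -[1+ 0 ] -[1+ m ] i))
  (cong (λ e → monoCoeff -[1+ 0 ] -[1+ m ] i + (monoCoeff (+ 1) e i + + 0)) (sym (exponent-cancel m)))) ⟩
  where
  swap : ∀ a b → a + (b + + 0) ≡ b + (a + + 0)
  swap = solve-∀
  exponent-cancel : ∀ m → -[1+ m ] + (+ m + + 1) ≡ + 0
  exponent-cancel m = trans (cong (λ t → -[1+ m ] + t) (trans (sym (ℤ.pos-+ m 1)) (cong +_ (ℕ.+-comm m 1)))) (ℤ.n⊖n≡0 (suc m))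

denAtQ-negTerms : ∀ m → denAtQ (negTerms m) ≋ pochDen -[1+ m ]
denAtQ-negTerms zero    = ≋-refl
denAtQ-negTerms (suc m) =
  ≋-trans (denAtQ-applyUpTo-suc _ m)
  (≋-trans (∙-cong (denAtQ-negTerms m) (≋-trans (identityʳ _) (factorAtQ-reflect m)))
  (≋-trans (solve 4 (λ a b c d → (a ⊕ b) ⊕ (c ⊕ d) ⊜ (a ⊕ c) ⊕ (b ⊕ d)) ≋-refl
                    (negPochMono m) (qqPoch m) (mono -[1+ 0 ] -[1+ m ]) (factorAtQ (+ m)))
           (∙-congʳ (≡⇒≋ (cong (mono (minusOnePow (suc m))) exponent)))))
  where
  exponent : - (+ tri m) + -[1+ m ] ≡ - (+ tri (suc m))
  exponent = sym (trans (cong -_ (ℤ.pos-+ (tri m) (suc m))) (ℤ.neg-distrib-+ (+ tri m) (+ suc m)))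

numAtQ-poch : ∀ x → numAtQ (poch x) ≋ pochNum x
numAtQ-poch (+ m)    = ≋-trans (≡⇒≋ (cong numAtQ (poch-+ m))) (numAtQ-posTerms m)
numAtQ-poch -[1+ m ] = ≡⇒≋ (begin
  numAtQ (poch -[1+ m ])   ≡⟨ cong numAtQ (poch-neg m) ⟩
  numAtQ (negTerms m)      ≡⟨ cong numAtQ (negTerms-upTo m) ⟩
  numAtQ (map _ (upTo m))  ≡⟨ numAtQ-denominators (upTo m) ⟩
  oneL                     ∎)
  where open ≡-Reasoning

denAtQ-poch : ∀ x → denAtQ (poch x) ≋ pochDen x
denAtQ-poch (+ m)    = ≡⇒≋ (denAtQ-numerators (upTo m))
denAtQ-poch -[1+ m ] = ≋-trans (≡⇒≋ (cong denAtQ (poch-neg m))) (denAtQ-negTerms m)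

orderAtQ-poch : ∀ x → orderAtQ (poch x) ≡ pochOrder x
orderAtQ-poch (+ m)    = orderAtQ-numerators (upTo m)
orderAtQ-poch -[1+ m ] = begin
  orderAtQ (poch -[1+ m ])              ≡⟨ cong orderAtQ (poch-neg m) ⟩
  -[1+ 0 ] + orderAtQ (negTerms m)      ≡⟨ cong (λ fs → -[1+ 0 ] + orderAtQ fs) (negTerms-upTo m) ⟩
  -[1+ 0 ] + orderAtQ (map _ (upTo m))  ≡⟨ cong (λ o → -[1+ 0 ] + o) (orderAtQ-denominators (upTo m)) ⟩
  -[1+ 0 ]                              ∎
  where open ≡-Reasoning

pochRatio : ℤ → ℤ → ℤ → Factors
pochRatio N K d = poch N ++ invF (poch K) ++ invF (poch d)

numAtQ-pochRatio : ∀ N K d → numAtQ (pochRatio N K d) ≋ pochNum N ⊗ (pochDen K ⊗ pochDen d)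
numAtQ-pochRatio N K d =
  ≋-trans (numAtQ-++ (poch N) _) (∙-cong (numAtQ-poch N)
  (≋-trans (numAtQ-++ (invF (poch K)) _)
  (∙-cong (≋-trans (≡⇒≋ (numAtQ-invF (poch K))) (denAtQ-poch K))
          (≋-trans (≡⇒≋ (numAtQ-invF (poch d))) (denAtQ-poch d)))))

denAtQ-pochRatio : ∀ N K d → denAtQ (pochRatio N K d) ≋ pochDen N ⊗ (pochNum K ⊗ pochNum d)
denAtQ-pochRatio N K d =
  ≋-trans (denAtQ-++ (poch N) _) (∙-cong (denAtQ-poch N)
  (≋-trans (denAtQ-++ (invF (poch K)) _)
  (∙-cong (≋-trans (≡⇒≋ (denAtQ-invF (poch K))) (numAtQ-poch K))
          (≋-trans (≡⇒≋ (denAtQ-invF (poch d))) (numAtQ-poch d)))))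

orderAtQ-pochRatio : ∀ N K d → orderAtQ (pochRatio N K d) ≡ pochOrder N + (- pochOrder K + - pochOrder d)
orderAtQ-pochRatio N K d =
  trans (orderAtQ-++ (poch N) _) (cong₂ _+_ (orderAtQ-poch N)
  (trans (orderAtQ-++ (invF (poch K)) _)
  (cong₂ _+_ (trans (orderAtQ-invF (poch K)) (cong -_ (orderAtQ-poch K)))
             (trans (orderAtQ-invF (poch d)) (cong -_ (orderAtQ-poch d))))))

limAtQ-regular : ∀ fs → orderAtQ fs ≡ + 0 → limAtQ fs ≡ just (evalAtQ fs)
limAtQ-regular fs ord≡0 rewrite ord≡0 = refl

limAtQ-vanishing : ∀ fs o → orderAtQ fs ≡ + suc o → limAtQ fs ≡ just (zeroL / oneL)
limAtQ-vanishing fs o ord≡1+o rewrite ord≡1+o = refl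

-- For o > 0 both limits vanish; for o = 0 both are fractions, compared by cross-multiplying.
scale-limAtQ-≈ : ∀ fs gs c e c′ e′ o → orderAtQ fs ≡ + o → orderAtQ gs ≡ + o →
  (o ≡ 0 → (mono c e ⊗ numAtQ fs) ⊗ denAtQ gs ≋ (mono c′ e′ ⊗ numAtQ gs) ⊗ denAtQ fs) →
  scale c e (limAtQ fs) ≈ scale c′ e′ (limAtQ gs)
scale-limAtQ-≈ fs gs c e c′ e′ zero ordf ordg cross
  rewrite limAtQ-regular fs ordf | limAtQ-regular gs ordg
        | num-evalAtQ fs | num-evalAtQ gs | den-evalAtQ fs | den-evalAtQ gs = coeff-≡ (cross refl)
scale-limAtQ-≈ fs gs c e c′ e′ (suc o) ordf ordg _
  rewrite limAtQ-vanishing fs o ordf | limAtQ-vanishing gs o ordg = λ _ → refl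

scale-oneˡ : ∀ X Y → scale (+ 1) (+ 0) X ≈ Y → X ≈ Y
scale-oneˡ (just x) (just y) 1x≈y i = trans (sym (coeff-≡ (∙-congʳ {den y} (identityˡ (num x))) i)) (1x≈y i)

scale-oneʳ : ∀ X Y → X ≈ scale (+ 1) (+ 0) Y → X ≈ Y
scale-oneʳ (just x) (just y) x≈1y i = trans (x≈1y i) (coeff-≡ (∙-congʳ {den x} (identityˡ (num y))) i)

cross-pochRatio : ∀ c e N K d N′ K′ d′ →
  (mono c e ⊗ numAtQ (pochRatio N K d)) ⊗ denAtQ (pochRatio N′ K′ d′)
    ≋ (mono c e ⊗ (pochNum N ⊗ (pochDen K ⊗ pochDen d))) ⊗ (pochDen N′ ⊗ (pochNum K′ ⊗ pochNum d′))
cross-pochRatio c e N K d N′ K′ d′ =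
  ∙-cong (∙-congˡ {mono c e} (numAtQ-pochRatio N K d)) (denAtQ-pochRatio N′ K′ d′)

scale-pochRatio-≈ : ∀ N K d N′ K′ d′ c e c′ e′ o →
  pochOrder N + (- pochOrder K + - pochOrder d) ≡ + o →
  pochOrder N′ + (- pochOrder K′ + - pochOrder d′) ≡ + o →
  (o ≡ 0 → (mono c e ⊗ (pochNum N ⊗ (pochDen K ⊗ pochDen d))) ⊗ (pochDen N′ ⊗ (pochNum K′ ⊗ pochNum d′))
         ≋ (mono c′ e′ ⊗ (pochNum N′ ⊗ (pochDen K′ ⊗ pochDen d′))) ⊗ (pochDen N ⊗ (pochNum K ⊗ pochNum d))) →
  scale c e (limAtQ (pochRatio N K d)) ≈ scale c′ e′ (limAtQ (pochRatio N′ K′ d′))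
scale-pochRatio-≈ N K d N′ K′ d′ c e c′ e′ o ord ord′ cross =
  scale-limAtQ-≈ (pochRatio N K d) (pochRatio N′ K′ d′) c e c′ e′ o
    (trans (orderAtQ-pochRatio N K d) ord) (trans (orderAtQ-pochRatio N′ K′ d′) ord′)
    (λ o≡0 → ≋-trans (cross-pochRatio c e N K d N′ K′ d′)
               (≋-trans (cross o≡0) (≋-sym (cross-pochRatio c′ e′ N′ K′ d′ N K d))))

-- Symmetry

orderAtQ-pochRatio-nonneg : ∀ N K d → N ≡ d + K → Σ ℕ λ o → pochOrder N + (- pochOrder K + - pochOrder d) ≡ + o
orderAtQ-pochRatio-nonneg (+ _)    (+ _)    (+ _)    _  = 0 , refl
orderAtQ-pochRatio-nonneg (+ _)    (+ _)    -[1+ _ ] _  = 1 , refl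
orderAtQ-pochRatio-nonneg (+ _)    -[1+ _ ] (+ _)    _  = 1 , refl
orderAtQ-pochRatio-nonneg (+ _)    -[1+ _ ] -[1+ _ ] _  = 2 , refl
orderAtQ-pochRatio-nonneg -[1+ _ ] (+ _)    (+ _)    ()
orderAtQ-pochRatio-nonneg -[1+ _ ] (+ _)    -[1+ _ ] _  = 0 , refl
orderAtQ-pochRatio-nonneg -[1+ _ ] -[1+ _ ] (+ _)    _  = 0 , refl
orderAtQ-pochRatio-nonneg -[1+ _ ] -[1+ _ ] -[1+ _ ] _  = 1 , refl

scale-pochRatio-swap : ∀ c e N K d → N ≡ d + K →
  scale c e (limAtQ (pochRatio N K d)) ≈ scale c e (limAtQ (pochRatio N d K))
scale-pochRatio-swap c e N K d N≡d+K with orderAtQ-pochRatio-nonneg N K d N≡d+K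
... | o , ord≡o = scale-pochRatio-≈ N K d N d K c e c e o ord≡o
  (trans (cong (λ o → pochOrder N + o) (ℤ.+-comm (- pochOrder d) (- pochOrder K))) ord≡o)
  (λ _ → solve 7 (λ m a b c x y z →
                   (m ⊕ (a ⊕ (b ⊕ c))) ⊕ (x ⊕ (y ⊕ z)) ⊜ (m ⊕ (a ⊕ (c ⊕ b))) ⊕ (x ⊕ (z ⊕ y)))
                 ≋-refl (mono c e) (pochNum N) (pochDen K) (pochDen d) (pochDen N) (pochNum d) (pochNum K))

scale-qbinom-symmetric : ∀ c e N K {K′} → N - K ≡ K′ → scale c e (qbinom N K) ≈ scale c e (qbinom N K′)
scale-qbinom-symmetric c e N K refl =
  subst (λ d → scale c e (limAtQ (pochRatio N K (N - K))) ≈ scale c e (limAtQ (pochRatio N (N - K) d)))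
        (sym (involutive N K)) (scale-pochRatio-swap c e N K (N - K) (sym (cancel N K)))
  where
  involutive : ∀ N K → N - (N - K) ≡ K
  involutive = solve-∀
  cancel : ∀ N K → N - K + K ≡ N
  cancel = solve-∀

-- Reflection

minusOnePow-+ : ∀ m n → minusOnePow (m ℕ.+ n) ≡ minusOnePow m * minusOnePow n
minusOnePow-+ zero    n = sym (ℤ.*-identityˡ (minusOnePow n))
minusOnePow-+ (suc m) n rewrite minusOnePow-+ m n = reorder (minusOnePow m) (minusOnePow n)
  where
  reorder : ∀ x y → x * y * -[1+ 0 ] ≡ x * -[1+ 0 ] * y
  reorder = solve-∀

minusOnePow-square : ∀ m → minusOnePow m * minusOnePow m ≡ + 1
minusOnePow-square zero    = refl
minusOnePow-square (suc m) = trans (reorder (minusOnePow m)) (minusOnePow-square m)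
  where
  reorder : ∀ x → x * -[1+ 0 ] * (x * -[1+ 0 ]) ≡ x * x
  reorder = solve-∀

exponent-cancel : ∀ {e e′ A Z} → e′ ≡ e + (A - Z) → e′ + - A ≡ e + - Z
exponent-cancel {e} {e′} {A} {Z} e′≡ = trans (cong (λ x → x + - A) e′≡) (cancel e A Z)
  where
  cancel : ∀ e A Z → e + (A - Z) + - A ≡ e + - Z
  cancel = solve-∀

≋-common-factor : ∀ {X Y} M M′ P → X ≋ M ⊗ P → Y ≋ M′ ⊗ P → M ≡ M′ → X ≋ Y
≋-common-factor M .M P X≋MP Y≋MP refl = ≋-trans X≋MP (≋-sym Y≋MP)

-- In each regular case both cross products are a monomial times the q-factorials of the three
-- nonnegative indices involved; the cases differ in which index is the sum of the other two.

reflect-pos-pos : ∀ a b z c e c′ e′ → a ≡ z ℕ.+ b → c′ ≡ c * minusOnePow b → e′ ≡ e + (+ tri a - + tri z) →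
  scale c e (limAtQ (pochRatio (+ a) (+ b) (+ z))) ≈ scale c′ e′ (limAtQ (pochRatio -[1+ z ] (+ b) -[1+ a ]))
reflect-pos-pos a b z c e c′ e′ a≡z+b c′≡ e′≡ =
  scale-pochRatio-≈ (+ a) (+ b) (+ z) -[1+ z ] (+ b) -[1+ a ] c e c′ e′ 0 refl refl λ _ →
  ≋-common-factor (mono c e ⊗ negPochMono z) (mono c′ e′ ⊗ negPochMono a) (qqPoch a ⊗ (qqPoch b ⊗ qqPoch z))
    (solve 5 (λ m Mz Qa Qz Qb → (m ⊕ (Qa ⊕ (id ⊕ id))) ⊕ ((Mz ⊕ Qz) ⊕ (Qb ⊕ id)) ⊜ (m ⊕ Mz) ⊕ (Qa ⊕ (Qb ⊕ Qz)))
        ≋-refl (mono c e) (negPochMono z) (qqPoch a) (qqPoch z) (qqPoch b))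
    (solve 5 (λ m Ma Qa Qb Qz → (m ⊕ (id ⊕ (id ⊕ (Ma ⊕ Qa)))) ⊕ (id ⊕ (Qb ⊕ Qz)) ⊜ (m ⊕ Ma) ⊕ (Qa ⊕ (Qb ⊕ Qz)))
        ≋-refl (mono c′ e′) (negPochMono a) (qqPoch a) (qqPoch b) (qqPoch z))
    (cong₂ mono (sym coefficient) (sym (exponent-cancel {e = e} {Z = + tri z} e′≡)))
  where
  open ≡-Reasoning
  coefficient : c′ * minusOnePow a ≡ c * minusOnePow z
  coefficient = begin
    c′ * minusOnePow a                                 ≡⟨ cong₂ _*_ c′≡ (cong minusOnePow a≡z+b) ⟩
    c * minusOnePow b * minusOnePow (z ℕ.+ b)          ≡⟨ cong (λ x → c * minusOnePow b * x) (minusOnePow-+ z b) ⟩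
    c * minusOnePow b * (minusOnePow z * minusOnePow b) ≡⟨ regroup c (minusOnePow b) (minusOnePow z) ⟩
    c * minusOnePow z * (minusOnePow b * minusOnePow b) ≡⟨ cong (λ x → c * minusOnePow z * x) (minusOnePow-square b) ⟩
    c * minusOnePow z * + 1                            ≡⟨ ℤ.*-identityʳ _ ⟩
    c * minusOnePow z                                  ∎
    where
    regroup : ∀ c x y → c * x * (y * x) ≡ c * y * (x * x)
    regroup = solve-∀

reflect-neg-pos : ∀ a b z c e c′ e′ → z ≡ a ℕ.+ b → c′ ≡ c * minusOnePow b → e′ ≡ e + (+ tri a - + tri z) →
  scale c e (limAtQ (pochRatio -[1+ a ] (+ b) -[1+ z ])) ≈ scale c′ e′ (limAtQ (pochRatio (+ z) (+ b) (+ a)))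
reflect-neg-pos a b z c e c′ e′ z≡a+b c′≡ e′≡ =
  scale-pochRatio-≈ -[1+ a ] (+ b) -[1+ z ] (+ z) (+ b) (+ a) c e c′ e′ 0 refl refl λ _ →
  ≋-common-factor (mono c e ⊗ negPochMono z) (mono c′ e′ ⊗ negPochMono a) (qqPoch z ⊗ (qqPoch b ⊗ qqPoch a))
    (solve 5 (λ m Mz Qz Qb Qa → (m ⊕ (id ⊕ (id ⊕ (Mz ⊕ Qz)))) ⊕ (id ⊕ (Qb ⊕ Qa)) ⊜ (m ⊕ Mz) ⊕ (Qz ⊕ (Qb ⊕ Qa)))
        ≋-refl (mono c e) (negPochMono z) (qqPoch z) (qqPoch b) (qqPoch a))
    (solve 5 (λ m Ma Qz Qb Qa → (m ⊕ (Qz ⊕ (id ⊕ id))) ⊕ ((Ma ⊕ Qa) ⊕ (Qb ⊕ id)) ⊜ (m ⊕ Ma) ⊕ (Qz ⊕ (Qb ⊕ Qa)))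
        ≋-refl (mono c′ e′) (negPochMono a) (qqPoch z) (qqPoch b) (qqPoch a))
    (cong₂ mono coefficient (sym (exponent-cancel {e = e} {Z = + tri z} e′≡)))
  where
  open ≡-Reasoning
  coefficient : c * minusOnePow z ≡ c′ * minusOnePow a
  coefficient = begin
    c * minusOnePow z                         ≡⟨ cong (λ n → c * minusOnePow n) z≡a+b ⟩
    c * minusOnePow (a ℕ.+ b)                 ≡⟨ cong (c *_) (minusOnePow-+ a b) ⟩
    c * (minusOnePow a * minusOnePow b)       ≡⟨ regroup c (minusOnePow a) (minusOnePow b) ⟩
    c * minusOnePow b * minusOnePow a         ≡⟨ cong (_* minusOnePow a) c′≡ ⟨
    c′ * minusOnePow a                        ∎
    where
    regroup : ∀ c x y → c * (x * y) ≡ c * y * x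
    regroup = solve-∀

reflect-neg-neg : ∀ a b z c e c′ e′ → b ≡ z ℕ.+ a → c′ ≡ c * minusOnePow b → e′ ≡ e + (+ tri a - + tri z) →
  scale c e (limAtQ (pochRatio -[1+ a ] -[1+ b ] (+ z))) ≈ scale c′ e′ (limAtQ (pochRatio -[1+ z ] -[1+ b ] (+ a)))
reflect-neg-neg a b z c e c′ e′ b≡z+a c′≡ e′≡ =
  scale-pochRatio-≈ -[1+ a ] -[1+ b ] (+ z) -[1+ z ] -[1+ b ] (+ a) c e c′ e′ 0 refl refl λ _ →
  ≋-common-factor (mono c e ⊗ (negPochMono b ⊗ negPochMono z)) (mono c′ e′ ⊗ (negPochMono b ⊗ negPochMono a))
                  (qqPoch b ⊗ (qqPoch z ⊗ qqPoch a))
    (solve 6 (λ m Mb Mz Qb Qz Qa →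
                (m ⊕ (id ⊕ ((Mb ⊕ Qb) ⊕ id))) ⊕ ((Mz ⊕ Qz) ⊕ (id ⊕ Qa)) ⊜ (m ⊕ (Mb ⊕ Mz)) ⊕ (Qb ⊕ (Qz ⊕ Qa)))
        ≋-refl (mono c e) (negPochMono b) (negPochMono z) (qqPoch b) (qqPoch z) (qqPoch a))
    (solve 6 (λ m Mb Ma Qb Qz Qa →
                (m ⊕ (id ⊕ ((Mb ⊕ Qb) ⊕ id))) ⊕ ((Ma ⊕ Qa) ⊕ (id ⊕ Qz)) ⊜ (m ⊕ (Mb ⊕ Ma)) ⊕ (Qb ⊕ (Qz ⊕ Qa)))
        ≋-refl (mono c′ e′) (negPochMono b) (negPochMono a) (qqPoch b) (qqPoch z) (qqPoch a))
    (cong₂ mono coefficient exponent)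
  where
  open ≡-Reasoning
  σ : ℕ → ℤ
  σ = minusOnePow
  coefficient : c * (σ b * σ z) ≡ c′ * (σ b * σ a)
  coefficient = begin
    c * (σ b * σ z)                   ≡⟨ cong (λ n → c * (σ n * σ z)) b≡z+a ⟩
    c * (σ (z ℕ.+ a) * σ z)           ≡⟨ cong (λ x → c * (x * σ z)) (minusOnePow-+ z a) ⟩
    c * (σ z * σ a * σ z)             ≡⟨ regroup c (σ z) (σ a) ⟩
    c * σ a * (σ z * σ z)             ≡⟨ cong (λ x → c * σ a * x) (minusOnePow-square z) ⟩
    c * σ a * + 1                     ≡⟨ cong (λ x → c * σ a * x) (minusOnePow-square b) ⟨
    c * σ a * (σ b * σ b)             ≡⟨ regroup′ c (σ a) (σ b) ⟩
    c * σ b * (σ b * σ a)             ≡⟨ cong (λ x → x * (σ b * σ a)) c′≡ ⟨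
    c′ * (σ b * σ a)                  ∎
    where
    regroup : ∀ c x y → c * (x * y * x) ≡ c * y * (x * x)
    regroup = solve-∀
    regroup′ : ∀ c x y → c * x * (y * y) ≡ c * y * (y * x)
    regroup′ = solve-∀
  exponent : e + (- (+ tri b) + - (+ tri z)) ≡ e′ + (- (+ tri b) + - (+ tri a))
  exponent = sym (trans (cong (λ x → x + (- (+ tri b) + - (+ tri a))) e′≡) (cancel e (+ tri a) (+ tri b) (+ tri z)))
    where
    cancel : ∀ e A B Z → e + (A - Z) + (- B + - A) ≡ e + (- B + - Z)
    cancel = solve-∀

triangular : ℤ → ℤ
triangular (+ m)    = + tri m
triangular -[1+ m ] = + tri m

neg-pos-pred : ∀ m → - (+ m) - + 1 ≡ -[1+ m ]
neg-pos-pred m = trans (distrib (+ m)) (cong -_ (ℤ.+-comm (+ m) (+ 1)))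
  where
  distrib : ∀ x → - x - + 1 ≡ - (x + + 1)
  distrib = solve-∀

*-neg-one-twice : ∀ x → x * -[1+ 0 ] * -[1+ 0 ] ≡ x
*-neg-one-twice = solve-∀

minusOnePow-parity : ∀ m → (if does (m ℕ.% 2 ℕ.≟ 0) then + 1 else -[1+ 0 ]) ≡ minusOnePow m
minusOnePow-parity zero          = refl
minusOnePow-parity (suc zero)    = refl
minusOnePow-parity (suc (suc m)) = begin
  (if does (suc (suc m) ℕ.% 2 ℕ.≟ 0) then + 1 else -[1+ 0 ]) ≡⟨ cong (λ r → if does (r ℕ.≟ 0) then + 1 else -[1+ 0 ]) m+2%2≡m%2 ⟩
  (if does (m ℕ.% 2 ℕ.≟ 0) then + 1 else -[1+ 0 ])           ≡⟨ minusOnePow-parity m ⟩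
  minusOnePow m                                              ≡⟨ *-neg-one-twice (minusOnePow m) ⟨
  minusOnePow (suc (suc m))                                  ∎
  where
  open ≡-Reasoning
  m+2%2≡m%2 : suc (suc m) ℕ.% 2 ≡ m ℕ.% 2
  m+2%2≡m%2 = trans (cong (ℕ._% 2) (ℕ.+-comm 2 m)) ([m+kn]%n≡m%n m 1 2)

negOnePow-∣∣ : ∀ x → negOnePow x ≡ minusOnePow ∣ x ∣
negOnePow-∣∣ x = minusOnePow-parity ∣ x ∣

scale-pochRatio-reflect : ∀ N K d c e c′ e′ → N ≡ d + K →
  (pochOrder N + (- pochOrder K + - pochOrder d) ≡ + 0 → c′ ≡ c * (negOnePow K * sgn K)) →
  e′ ≡ e + (triangular N - triangular d) →
  scale c e (limAtQ (pochRatio N K d)) ≈ scale c′ e′ (limAtQ (pochRatio (- d - + 1) K (- N - + 1)))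
scale-pochRatio-reflect (+ a) (+ b) (+ z) c e c′ e′ N≡d+K sign exponent
  rewrite neg-pos-pred z | neg-pos-pred a =
  reflect-pos-pos a b z c e c′ e′ (ℤ.+-injective N≡d+K)
    (trans (sign refl) (cong (c *_) (trans (ℤ.*-identityʳ _) (negOnePow-∣∣ (+ b))))) exponent
scale-pochRatio-reflect -[1+ a ] (+ b) -[1+ z ] c e c′ e′ N≡d+K sign exponent =
  reflect-neg-pos a b z c e c′ e′ z≡a+b
    (trans (sign refl) (cong (c *_) (trans (ℤ.*-identityʳ _) (negOnePow-∣∣ (+ b))))) exponent
  where
  z≡a+b : z ≡ a ℕ.+ b
  z≡a+b = ℕ.suc-injective (ℤ.+-injective (trans (move -[1+ z ] (+ b)) (cong (λ N → - N + + b) (sym N≡d+K))))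
    where
    move : ∀ d K → - d ≡ - (d + K) + K
    move = solve-∀
scale-pochRatio-reflect -[1+ a ] -[1+ b ] (+ z) c e c′ e′ N≡d+K sign exponent
  rewrite neg-pos-pred z =
  reflect-neg-neg a b z c e c′ e′ b≡z+a
    (trans (sign refl) (cong (c *_) (trans (cong (_* -[1+ 0 ]) (negOnePow-∣∣ -[1+ b ])) (*-neg-one-twice (minusOnePow b))))) exponent
  where
  b≡z+a : b ≡ z ℕ.+ a
  b≡z+a = ℕ.suc-injective (trans (ℤ.+-injective (trans (move (+ z) -[1+ b ]) (cong (λ N → + z - N) (sym N≡d+K))))
                                 (ℕ.+-suc z a))
    where
    move : ∀ d K → - K ≡ d - (d + K)
    move = solve-∀
scale-pochRatio-reflect (+ a) (+ b) -[1+ z ] c e c′ e′ _ _ _ rewrite neg-pos-pred a =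
  scale-pochRatio-≈ (+ a) (+ b) -[1+ z ] (+ z) (+ b) -[1+ a ] c e c′ e′ 1 refl refl λ ()
scale-pochRatio-reflect (+ a) -[1+ b ] (+ z) c e c′ e′ _ _ _ rewrite neg-pos-pred z | neg-pos-pred a =
  scale-pochRatio-≈ (+ a) -[1+ b ] (+ z) -[1+ z ] -[1+ b ] -[1+ a ] c e c′ e′ 1 refl refl λ ()
scale-pochRatio-reflect (+ a) -[1+ b ] -[1+ z ] c e c′ e′ _ _ _ rewrite neg-pos-pred a =
  scale-pochRatio-≈ (+ a) -[1+ b ] -[1+ z ] (+ z) -[1+ b ] -[1+ a ] c e c′ e′ 2 refl refl λ ()
scale-pochRatio-reflect -[1+ a ] (+ b) (+ z) c e c′ e′ () _ _
scale-pochRatio-reflect -[1+ a ] -[1+ b ] -[1+ z ] c e c′ e′ _ _ _ =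
  scale-pochRatio-≈ -[1+ a ] -[1+ b ] -[1+ z ] (+ z) -[1+ b ] (+ a) c e c′ e′ 1 refl refl λ ()

scale-qbinom-reflect : ∀ N K {N′} c e c′ e′ → K - N - + 1 ≡ N′ →
  (orderAtQ (qbinRatio N K) ≡ + 0 → c′ ≡ c * (negOnePow K * sgn K)) →
  e′ ≡ e + (triangular N - triangular (N - K)) →
  scale c e (qbinom N K) ≈ scale c′ e′ (qbinom N′ K)
scale-qbinom-reflect N K c e c′ e′ refl sign exponent =
  subst₂ (λ N′ d′ → scale c e (qbinom N K) ≈ scale c′ e′ (limAtQ (pochRatio N′ K d′)))
         (sym (upper N K)) (sym (lower N K))
         (scale-pochRatio-reflect N K (N - K) c e c′ e′ (sym (cancel N K))
           (λ ord → sign (trans (orderAtQ-pochRatio N K (N - K)) ord)) exponent)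
  where
  upper : ∀ N K → K - N - + 1 ≡ - (N - K) - + 1
  upper = solve-∀
  lower : ∀ N K → K - N - + 1 - K ≡ - N - + 1
  lower = solve-∀
  cancel : ∀ N K → N - K + K ≡ N
  cancel = solve-∀

-- Signs and exponents

minusOnePow-⊖ : ∀ m n → minusOnePow ∣ m ℤ.⊖ n ∣ ≡ minusOnePow m * minusOnePow n
minusOnePow-⊖ m       zero    = sym (ℤ.*-identityʳ (minusOnePow m))
minusOnePow-⊖ zero    (suc n) = sym (ℤ.*-identityˡ (minusOnePow (suc n)))
minusOnePow-⊖ (suc m) (suc n) =
  trans (cong (minusOnePow ∘ ∣_∣) (ℤ.[1+m]⊖[1+n]≡m⊖n m n))
        (trans (minusOnePow-⊖ m n) (regroup (minusOnePow m) (minusOnePow n)))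
  where
  regroup : ∀ x y → x * y ≡ x * -[1+ 0 ] * (y * -[1+ 0 ])
  regroup = solve-∀

negOnePow-+ : ∀ x y → negOnePow (x + y) ≡ negOnePow x * negOnePow y
negOnePow-+ x y rewrite negOnePow-∣∣ (x + y) | negOnePow-∣∣ x | negOnePow-∣∣ y = minusOnePow-∣+∣ x y
  where
  regroup : ∀ x y → x * y * -[1+ 0 ] * -[1+ 0 ] ≡ x * -[1+ 0 ] * (y * -[1+ 0 ])
  regroup = solve-∀
  minusOnePow-∣+∣ : ∀ x y → minusOnePow ∣ x + y ∣ ≡ minusOnePow ∣ x ∣ * minusOnePow ∣ y ∣
  minusOnePow-∣+∣ (+ m)    (+ n)    = minusOnePow-+ m n
  minusOnePow-∣+∣ (+ m)    -[1+ n ] = minusOnePow-⊖ m (suc n)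
  minusOnePow-∣+∣ -[1+ m ] (+ n)    = trans (minusOnePow-⊖ n (suc m)) (ℤ.*-comm (minusOnePow n) _)
  minusOnePow-∣+∣ -[1+ m ] -[1+ n ] =
    trans (cong (λ x → x * -[1+ 0 ] * -[1+ 0 ]) (minusOnePow-+ m n)) (regroup (minusOnePow m) (minusOnePow n))

negOnePow-neg : ∀ x → negOnePow (- x) ≡ negOnePow x
negOnePow-neg (+ zero)  = refl
negOnePow-neg (+ suc m) = refl
negOnePow-neg -[1+ m ]  = refl

negOnePow-square : ∀ x → negOnePow x * negOnePow x ≡ + 1
negOnePow-square x rewrite negOnePow-∣∣ x = minusOnePow-square ∣ x ∣

sgn-regular : ∀ N K d → pochOrder N + (- pochOrder K + - pochOrder d) ≡ + 0 → sgn N ≡ sgn K * sgn d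
sgn-regular (+ _)    (+ _)    (+ _)    _  = refl
sgn-regular (+ _)    (+ _)    -[1+ _ ] ()
sgn-regular (+ _)    -[1+ _ ] (+ _)    ()
sgn-regular (+ _)    -[1+ _ ] -[1+ _ ] ()
sgn-regular -[1+ _ ] (+ _)    (+ _)    ()
sgn-regular -[1+ _ ] (+ _)    -[1+ _ ] _  = refl
sgn-regular -[1+ _ ] -[1+ _ ] (+ _)    _  = refl
sgn-regular -[1+ _ ] -[1+ _ ] -[1+ _ ] ()

sgn-neg-pred : ∀ x → sgn (- x - + 1) ≡ - sgn x
sgn-neg-pred (+ m)    = cong sgn (neg-pos-pred m)
sgn-neg-pred -[1+ m ] = refl

neg-pred-difference : ∀ n k → - k - + 1 - (- n - + 1) ≡ n - k
neg-pred-difference = solve-∀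

reflect-sign : ∀ n k → orderAtQ (qbinRatio (- k - + 1) (- n - + 1)) ≡ + 0 →
  negOnePow k * sgn k ≡ negOnePow (n - k) * sgn (n - k) * (negOnePow (- n - + 1) * sgn (- n - + 1))
reflect-sign n k regular = sym (begin
  negOnePow (n - k) * sgn (n - k) * (negOnePow (- n - + 1) * sgn (- n - + 1))
    ≡⟨ cong₂ (λ x y → x * sgn (n - k) * y) (negOnePow-+ n (- k)) (cong₂ _*_ (negOnePow-+ (- n) (- + 1)) (sgn-neg-pred n)) ⟩
  negOnePow n * negOnePow (- k) * sgn (n - k) * (negOnePow (- n) * -[1+ 0 ] * - sgn n)
    ≡⟨ cong₂ (λ x y → negOnePow n * x * sgn (n - k) * (y * -[1+ 0 ] * - sgn n)) (negOnePow-neg k) (negOnePow-neg n) ⟩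
  negOnePow n * negOnePow k * sgn (n - k) * (negOnePow n * -[1+ 0 ] * - sgn n)
    ≡⟨ regroup (negOnePow n) (negOnePow k) (sgn (n - k)) (sgn n) ⟩
  negOnePow k * (sgn n * sgn (n - k)) * (negOnePow n * negOnePow n)
    ≡⟨ cong₂ (λ x y → negOnePow k * x * y) (sym sgn-k) (negOnePow-square n) ⟩
  negOnePow k * sgn k * + 1
    ≡⟨ ℤ.*-identityʳ _ ⟩
  negOnePow k * sgn k ∎)
  where
  open ≡-Reasoning
  regroup : ∀ a b s t → a * b * s * (a * -[1+ 0 ] * - t) ≡ b * (t * s) * (a * a)
  regroup = solve-∀
  sgn-k : sgn k ≡ sgn n * sgn (n - k)
  sgn-k = ℤ.neg-injective (begin
    - sgn k                           ≡⟨ sgn-neg-pred k ⟨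
    sgn (- k - + 1)                   ≡⟨ sgn-regular (- k - + 1) (- n - + 1) (n - k)
                                           (subst (λ d → pochOrder (- k - + 1) + (- pochOrder (- n - + 1) + - pochOrder d) ≡ + 0)
                                                  (neg-pred-difference n k)
                                                  (trans (sym (orderAtQ-pochRatio (- k - + 1) (- n - + 1) _)) regular)) ⟩
    sgn (- n - + 1) * sgn (n - k)     ≡⟨ cong (_* sgn (n - k)) (sgn-neg-pred n) ⟩
    - sgn n * sgn (n - k)             ≡⟨ ℤ.neg-distribˡ-* (sgn n) (sgn (n - k)) ⟨
    - (sgn n * sgn (n - k))           ∎)

double-tri : ∀ m → 2 ℕ.* tri m ≡ m ℕ.* (m ℕ.+ 1)
double-tri zero    = refl
double-tri (suc m) = begin
  2 ℕ.* (tri m ℕ.+ suc m)               ≡⟨ ℕ.*-distribˡ-+ 2 (tri m) (suc m) ⟩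
  2 ℕ.* tri m ℕ.+ 2 ℕ.* suc m           ≡⟨ cong (ℕ._+ 2 ℕ.* suc m) (double-tri m) ⟩
  m ℕ.* (m ℕ.+ 1) ℕ.+ 2 ℕ.* suc m       ≡⟨ expand m ⟩
  suc m ℕ.* (suc m ℕ.+ 1)               ∎
  where
  open ≡-Reasoning
  expand : ∀ m → m ℕ.* (m ℕ.+ 1) ℕ.+ 2 ℕ.* suc m ≡ suc m ℕ.* (suc m ℕ.+ 1)
  expand = ℕ-Solver.solve-∀

double-triangular : ∀ x → + 2 * triangular x ≡ x * (x + + 1)
double-triangular (+ m)    = trans (sym (ℤ.pos-* 2 (tri m))) (trans (cong +_ (double-tri m)) (ℤ.pos-* m (m ℕ.+ 1)))
double-triangular -[1+ m ] =
  trans (double-triangular (+ m)) (trans (reflect (+ m)) (cong (λ x → x * (x + + 1)) (neg-pos-pred m)))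
  where
  reflect : ∀ x → x * (x + + 1) ≡ (- x - + 1) * ((- x - + 1) + + 1)
  reflect = solve-∀

-- On negative numerators _/ℕ_ rounds down, so this relies on + 2 * y being even.
half-double : ∀ y → half (+ 2 * y) ≡ y
half-double (+ m)    = trans (cong half (sym (ℤ.pos-* 2 m)))
                             (cong +_ (trans (cong (ℕ._/ 2) (ℕ.*-comm 2 m)) (m*n/n≡m m 2)))
half-double -[1+ m ] = exact (m ℕ.+ (suc m ℕ.+ 0)) (suc m) (double m)
  where
  double : ∀ m → suc (m ℕ.+ (suc m ℕ.+ 0)) ≡ suc m ℕ.* 2
  double = ℕ-Solver.solve-∀
  exact : ∀ n k → suc n ≡ k ℕ.* 2 → -[1+ n ] ℤ./ℕ 2 ≡ - (+ k)
  exact n k eq with suc n ℕ.% 2 | trans (cong (ℕ._% 2) eq) (m*n%n≡0 k 2)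
  ... | .0 | refl = cong (λ u → - (+ u)) (trans (cong (ℕ._/ 2) eq) (m*n/n≡m k 2))

half-difference : ∀ x y → half (x * (x + + 1) - y * (y + + 1)) ≡ triangular x - triangular y
half-difference x y =
  trans (cong half (sym (trans (distrib (triangular x) (triangular y))
                               (cong₂ _-_ (double-triangular x) (double-triangular y)))))
        (half-double (triangular x - triangular y))
  where
  distrib : ∀ a b → + 2 * (a - b) ≡ + 2 * a - + 2 * b
  distrib = solve-∀

triangular-neg-pred : ∀ x → triangular (- x - + 1) ≡ triangular x
triangular-neg-pred (+ m)    = cong triangular (neg-pos-pred m)
triangular-neg-pred -[1+ m ] = refl

half-complement : ∀ n k → half (k * (+ 2 * n - k + + 1)) ≡ triangular n - triangular (n - k)
half-complement n k = trans (cong half (expand n k)) (half-difference n (n - k))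
  where
  expand : ∀ n k → k * (+ 2 * n - k + + 1) ≡ n * (n + + 1) - (n - k) * ((n - k) + + 1)
  expand = solve-∀

reflect-exponent₁ : ∀ n k → half (n * (n + + 1) - k * (k + + 1)) ≡ + 0 + (triangular n - triangular (n - (n - k)))
reflect-exponent₁ n k = trans (half-difference n k)
  (trans (cong (λ x → triangular n - triangular x) (sym (involutive n k))) (sym (ℤ.+-identityˡ _)))
  where
  involutive : ∀ n k → n - (n - k) ≡ k
  involutive = solve-∀

reflect-exponent₂ : ∀ n k → half (k * (+ 2 * n - k + + 1))
  ≡ half (n * (n + + 1) - k * (k + + 1)) + (triangular (- k - + 1) - triangular (- k - + 1 - (- n - + 1)))
reflect-exponent₂ n k = begin
  half (k * (+ 2 * n - k + + 1))                                      ≡⟨ half-complement n k ⟩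
  triangular n - triangular (n - k)                                   ≡⟨ telescope (triangular n) (triangular k) (triangular (n - k)) ⟩
  (triangular n - triangular k) + (triangular k - triangular (n - k))
    ≡⟨ cong₂ (λ x y → x + (y - triangular (n - k))) (half-difference n k) (triangular-neg-pred k) ⟨
  half (n * (n + + 1) - k * (k + + 1)) + (triangular (- k - + 1) - triangular (n - k))
    ≡⟨ cong (λ d → half (n * (n + + 1) - k * (k + + 1)) + (triangular (- k - + 1) - triangular d)) (neg-pred-difference n k) ⟨
  half (n * (n + + 1) - k * (k + + 1)) + (triangular (- k - + 1) - triangular (- k - + 1 - (- n - + 1))) ∎
  where
  open ≡-Reasoning
  telescope : ∀ a b c → a - c ≡ (a - b) + (b - c)
  telescope = solve-∀

corollary3p2 : (n k : ℤ) →
      (qbinom n k ≈ qbinom n (n - k))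
    × (qbinom n (n - k)
         ≈ scale (negOnePow (n - k) * sgn (n - k)) (half (n * (n + + 1) - k * (k + + 1)))
                 (qbinom (- k - + 1) (n - k)))
    × (scale (negOnePow (n - k) * sgn (n - k)) (half (n * (n + + 1) - k * (k + + 1)))
                 (qbinom (- k - + 1) (n - k))
         ≈ scale (negOnePow (n - k) * sgn (n - k)) (half (n * (n + + 1) - k * (k + + 1)))
                 (qbinom (- k - + 1) (- n - + 1)))
    × (scale (negOnePow (n - k) * sgn (n - k)) (half (n * (n + + 1) - k * (k + + 1)))
                 (qbinom (- k - + 1) (- n - + 1))
         ≈ scale (negOnePow k * sgn k) (half (k * (+ 2 * n - k + + 1)))
                 (qbinom (k - n - + 1) (- n - + 1)))
    × (scale (negOnePow k * sgn k) (half (k * (+ 2 * n - k + + 1)))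
                 (qbinom (k - n - + 1) (- n - + 1))
         ≈ scale (negOnePow k * sgn k) (half (k * (+ 2 * n - k + + 1)))
                 (qbinom (k - n - + 1) k))
corollary3p2 n k =
    scale-oneʳ _ _ (scale-oneˡ _ _ (scale-qbinom-symmetric (+ 1) (+ 0) n k refl))
  , scale-oneˡ _ _ (scale-qbinom-reflect n (n - k) (+ 1) (+ 0) c₁ e₁ (reflected₁ n k)
                     (λ _ → sym (ℤ.*-identityˡ c₁)) (reflect-exponent₁ n k))
  , scale-qbinom-symmetric c₁ e₁ (- k - + 1) (n - k) (complement₁ n k)
  , scale-qbinom-reflect (- k - + 1) (- n - + 1) c₁ e₁ c₂ e₂ (reflected₂ n k) (reflect-sign n k) (reflect-exponent₂ n k)
  , scale-qbinom-symmetric c₂ e₂ (k - n - + 1) (- n - + 1) (complement₂ n k)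
  where
  c₁ e₁ c₂ e₂ : ℤ
  c₁ = negOnePow (n - k) * sgn (n - k)
  e₁ = half (n * (n + + 1) - k * (k + + 1))
  c₂ = negOnePow k * sgn k
  e₂ = half (k * (+ 2 * n - k + + 1))
  reflected₁ : ∀ n k → n - k - n - + 1 ≡ - k - + 1
  reflected₁ = solve-∀
  complement₁ : ∀ n k → - k - + 1 - (n - k) ≡ - n - + 1
  complement₁ = solve-∀
  reflected₂ : ∀ n k → - n - + 1 - (- k - + 1) - + 1 ≡ k - n - + 1
  reflected₂ = solve-∀
  complement₂ : ∀ n k → k - n - + 1 - (- n - + 1) ≡ k
  complement₂ = solve-∀
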